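{- Let $G$ be the labeled graph with four nodes $u_1,u_2,u_3,u_4$, labels $\ell(u_j)=j$, and edges $(u_1,u_2),(u_2,u_3),(u_3,u_4),(u_1,u_4)$. Then there is no finite standard set $\Delta$ whose canonicalized standard graph $G'(\Delta)$ is isomorphic (as a labeled graph) to $G$.
   Context: A finite standard set is a finite $\Delta\subseteq\mathbb{N}^d$ whose complement $C$ satisfies $C+\mathbb{N}^d=C$. Let $q^d\colon\mathbb{N}^d\to\mathbb{N}^{d-1}$ forget the last coordinate and $h_\Delta(\gamma)=|(q^d)^{ -1}(\gamma)\cap\Delta|$. For $a\ge1$ the isohypse $\Delta^a=\{\gamma\in q^d(\Delta):h_\Delta(\gamma)=a\}$. A subset of $\mathbb{N}^{d-1}$ is connected if any two of its points are joined by a sequence in it whose consecutive terms differ by some $\pm e_i$ ($e_i$ standard basis vectors); connected components are maximal connected subsets. $G'(\Delta)$ has as nodes the connected components of all isohypses, the component of $\Delta^a$ having label $a$, and an edge from a component $B$ to a different component $B'$ iff there are $\gamma'\in B,\gamma\in B'$ with $\gamma'=\gamma+e_i$ for some $i$. -}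

module Defs where

open import Data.Nat using (ℕ; zero; suc; _+_; _≤_)
open import Data.Fin using (Fin; toℕ) renaming (zero to f0; suc to fs)
open import Data.Fin.Properties using () renaming (_≟_ to _≟F_)
open import Data.Vec using (Vec; _∷ʳ_; zipWith; tabulate)
open import Data.List using (List; length)
open import Data.List.Membership.Propositional using (_∈_)
open import Data.List.Relation.Unary.Unique.Propositional using (Unique)
open import Data.Product using (Σ; _×_; ∃)
open import Data.Sum using (_⊎_)
open import Data.Bool using (if_then_else_)
open import Relation.Nullary using (¬_)
open import Relation.Nullary.Decidable using (⌊_⌋)
open import Relation.Binary.PropositionalEquality using (_≡_; _≢_)
open import Function.Bundles using (_⇔_)

Pt : ℕ → Set
Pt d = Vec ℕ d

_+ᵥ_ : ∀ {d} → Pt d → Pt d → Pt d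
_+ᵥ_ = zipWith _+_

e : ∀ {d} → Fin d → Pt d
e i = tabulate (λ j → if ⌊ i ≟F j ⌋ then 1 else 0)

FinSet : ℕ → Set
FinSet d = List (Pt d)

-- Δ is a standard set: its complement C satisfies C + ℕ^d = C
-- (C + ℕ^d ⊇ C is trivial; C + ℕ^d ⊆ C is the condition below)
IsStandard : ∀ {d} → FinSet d → Set
IsStandard {d} Δ = (x y : Pt d) → ¬ (x ∈ Δ) → ¬ ((x +ᵥ y) ∈ Δ)

-- h_Δ(γ) = a, for Δ ⊆ ℕ^(n+1) and γ ∈ ℕ^n, where q forgets the last
-- coordinate: the fibre q⁻¹(γ) ∩ Δ = {γ∷ʳk ∈ Δ} has exactly a elements
-- (listed without repetition by ks).
HasHeight : ∀ {n} → FinSet (suc n) → Pt n → ℕ → Set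
HasHeight Δ γ a =
  Σ (List ℕ) λ ks → Unique ks × ((k : ℕ) → (k ∈ ks) ⇔ ((γ ∷ʳ k) ∈ Δ)) × length ks ≡ a

InIsohypse : ∀ {n} → FinSet (suc n) → ℕ → Pt n → Set
InIsohypse Δ a γ = (1 ≤ a) × HasHeight Δ γ a

Adjacent : ∀ {n} → Pt n → Pt n → Set
Adjacent {n} γ γ' = Σ (Fin n) λ i → (γ' ≡ γ +ᵥ e i) ⊎ (γ ≡ γ' +ᵥ e i)

data Chain {n : ℕ} (S : Pt n → Set) : Pt n → Pt n → Set where
  here : ∀ {x} → S x → Chain S x x
  step : ∀ {x y z} → S x → Adjacent x y → Chain S y z → Chain S x z

-- the labeled graph G: nodes u₁..u₄ as Fin 4, ℓ(u_j) = j
label : Fin 4 → ℕ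
label j = suc (toℕ j)

data GEdge : Fin 4 → Fin 4 → Set where
  e12 : GEdge f0 (fs f0)
  e23 : GEdge (fs f0) (fs (fs f0))
  e34 : GEdge (fs (fs f0)) (fs (fs (fs f0)))
  e14 : GEdge f0 (fs (fs (fs f0)))

-- A labeled-graph isomorphism G'(Δ) ≅ G, unfolded: composing the bijection
-- {components} → Fin 4 with the map sending a point of an isohypse to its
-- component gives c; c is well defined and injective on components
-- (sameComp), surjective, label-preserving, and edges correspond.
record IsoToG {n : ℕ} (Δ : FinSet (suc n)) (c : Pt n → Fin 4) : Set where
  field
    sameComp : ∀ γ γ' a a' → InIsohypse Δ a γ → InIsohypse Δ a' γ' →
               (c γ ≡ c γ') ⇔ ((a ≡ a') × Chain (InIsohypse Δ a) γ γ')
    surj     : ∀ j → Σ (Pt n) λ γ → Σ ℕ λ a → InIsohypse Δ a γ × c γ ≡ j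
    labels   : ∀ γ a → InIsohypse Δ a γ → a ≡ label (c γ)
    edges    : ∀ j j' → GEdge j j' ⇔
               ((j ≢ j') × Σ (Pt n) λ γ' → Σ (Pt n) λ γ → Σ ℕ λ a' → Σ ℕ λ a →
                 Σ (Fin n) λ i → InIsohypse Δ a' γ' × InIsohypse Δ a γ ×
                 c γ' ≡ j × c γ ≡ j' × γ' ≡ γ +ᵥ e i)

-- Heights h_Δ decrease upwards in ℕⁿ (Δ is closed downwards), and an
-- isomorphism with G forbids unit steps from height 2 down to height 4 and
-- from height 1 down to height 3.  Call x "clear" if no point of height 2 lies
-- below x.  The edge (u₁,u₄) yields a clear point γ' of height 1 (it is a unit
-- step above a point of height 4).  Clearness propagates along paths of height
-- 1: the only way to lose it is a new point of height 2 whose lower neighbour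
-- has height 2, 3 or 4, and each case is excluded (height 3 by a discrete
-- intermediate value argument).  So the whole node u₁ is clear, contradicting
-- the edge (u₁,u₂), which puts a point of height 2 right below a point of u₁.

module Submission where

open import Defs
open import Data.Nat using (ℕ; zero; suc; _+_; _≤_; _<_; s≤s; z≤n)
open import Data.Nat.Properties
  using (+-assoc; +-comm; +-suc; +-identityʳ; suc-injective; ≤-trans; ≤-antisym; _≟_)
open import Data.Fin using (Fin) renaming (zero to f0; suc to fs)
open import Data.Fin.Properties using (toℕ<n) renaming (_≟_ to _≟F_)
open import Data.Vec using ([]; _∷_; _∷ʳ_; tabulate; updateAt; sum; last)
open import Data.Vec.Properties using (tabulate-cong; zipWith-assoc; ∷-injective; ≡-dec; last-∷ʳ)
open import Data.List using (List; []; _∷_; _++_; length; map; filter; upTo)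
open import Data.List.Properties using (length-++)
open import Data.List.Membership.Propositional using (_∈_)
open import Data.List.Membership.Propositional.Properties
  using (∈-∃++; ∈-++⁻; ∈-++⁺ˡ; ∈-++⁺ʳ; ∈-map⁺; ∈-filter⁺; ∈-filter⁻; ∈-upTo⁺)
open import Data.List.Relation.Unary.Any using (here; there)
open import Data.List.Relation.Unary.All as All using ()
open import Data.List.Relation.Unary.AllPairs using (_∷_)
open import Data.List.Relation.Unary.Unique.Propositional using (Unique)
open import Data.List.Relation.Unary.Unique.Propositional.Properties using (filter⁺; upTo⁺)
open import Data.List.Extrema.Nat using (max; xs≤max)
open import Data.Product using (Σ; _×_; _,_; proj₂)
open import Data.Sum using (_⊎_; inj₁; inj₂)
open import Data.Bool using (if_then_else_)
open import Data.Empty using (⊥)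
open import Function using (_∘_)
open import Function.Bundles using (_⇔_; mk⇔; Equivalence)
open import Relation.Nullary using (¬_; Dec; yes; no; contradiction)
open import Relation.Nullary.Decidable using (⌊_⌋)
open import Relation.Binary.PropositionalEquality

-- The zero vector of ℕⁿ, in the form in which it occurs inside e i.
0ᵥ : ∀ {n} → Pt n
0ᵥ = tabulate (λ _ → 0)

+ᵥ-identityʳ : ∀ {n} (x : Pt n) → x +ᵥ 0ᵥ ≡ x
+ᵥ-identityʳ [] = refl
+ᵥ-identityʳ (a ∷ x) = cong₂ _∷_ (+-identityʳ a) (+ᵥ-identityʳ x)

+ᵥ-e : ∀ {n} (x : Pt n) (i : Fin n) → x +ᵥ e i ≡ updateAt x i suc
+ᵥ-e (a ∷ x) f0 = cong₂ _∷_ (+-comm a 1) (+ᵥ-identityʳ x)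
+ᵥ-e (a ∷ x) (fs i) = cong₂ _∷_ (+-identityʳ a) (trans (cong (x +ᵥ_) e-tail) (+ᵥ-e x i))
  where
  does-suc : ∀ j → ⌊ fs i ≟F fs j ⌋ ≡ ⌊ i ≟F j ⌋
  does-suc j with i ≟F j
  ... | yes _ = refl
  ... | no _ = refl
  e-tail : tabulate (λ j → if ⌊ fs i ≟F fs j ⌋ then 1 else 0) ≡ e i
  e-tail = tabulate-cong (λ j → cong (if_then 1 else 0) (does-suc j))

+ᵥ-updateAt : ∀ {n} (x v : Pt n) (i : Fin n) → x +ᵥ updateAt v i suc ≡ updateAt x i suc +ᵥ v
+ᵥ-updateAt (a ∷ x) (b ∷ v) f0 = cong (_∷ (x +ᵥ v)) (+-suc a b)
+ᵥ-updateAt (a ∷ x) (b ∷ v) (fs i) = cong ((a + b) ∷_) (+ᵥ-updateAt x v i)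

-- A unit increment raises the coordinate sum by one; this is the measure
-- for descending induction.
sum-updateAt : ∀ {n} (v : Pt n) (i : Fin n) → sum (updateAt v i suc) ≡ suc (sum v)
sum-updateAt (b ∷ v) f0 = refl
sum-updateAt (b ∷ v) (fs i) = trans (cong (b +_) (sum-updateAt v i)) (+-suc b (sum v))

zero-or-increment : ∀ {n} (v : Pt n) →
  v ≡ 0ᵥ ⊎ Σ (Fin n) λ i → Σ (Pt n) λ v' → v ≡ updateAt v' i suc
zero-or-increment [] = inj₁ refl
zero-or-increment (suc b ∷ v) = inj₂ (f0 , b ∷ v , refl)
zero-or-increment (zero ∷ v) with zero-or-increment v
... | inj₁ refl = inj₁ refl
... | inj₂ (i , v' , refl) = inj₂ (fs i , zero ∷ v' , refl)

+ᵥ-split : ∀ {n} (y v z : Pt n) (i : Fin n) → y +ᵥ v ≡ updateAt z i suc →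
  (Σ (Pt n) λ v' → v ≡ updateAt v' i suc × y +ᵥ v' ≡ z) ⊎
  (Σ (Pt n) λ y' → y ≡ updateAt y' i suc × y' +ᵥ v ≡ z)
+ᵥ-split (a ∷ y) (suc b ∷ v) (c ∷ z) f0 eq with ∷-injective eq
... | a+1+b≡1+c , y+v≡z =
  inj₁ (b ∷ v , refl , cong₂ _∷_ (suc-injective (trans (sym (+-suc a b)) a+1+b≡1+c)) y+v≡z)
+ᵥ-split (suc a ∷ y) (zero ∷ v) (c ∷ z) f0 eq with ∷-injective eq
... | 1+a+0≡1+c , y+v≡z = inj₂ (a ∷ y , refl , cong₂ _∷_ (suc-injective 1+a+0≡1+c) y+v≡z)
+ᵥ-split (zero ∷ y) (zero ∷ v) (c ∷ z) f0 ()
+ᵥ-split (a ∷ y) (b ∷ v) (c ∷ z) (fs i) eq with ∷-injective eq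
... | a+b≡c , y+v≡z with +ᵥ-split y v z i y+v≡z
...   | inj₁ (v' , refl , y+v'≡z) = inj₁ (b ∷ v' , refl , cong₂ _∷_ a+b≡c y+v'≡z)
...   | inj₂ (y' , refl , y'+v≡z) = inj₂ (a ∷ y' , refl , cong₂ _∷_ a+b≡c y'+v≡z)

_≼_ : ∀ {n} → Pt n → Pt n → Set
_≼_ {n} y x = Σ (Pt n) λ v → x ≡ y +ᵥ v

≼-refl : ∀ {n} {x : Pt n} → x ≼ x
≼-refl {x = x} = 0ᵥ , sym (+ᵥ-identityʳ x)

≼-trans : ∀ {n} {x y z : Pt n} → z ≼ y → y ≼ x → z ≼ x
≼-trans {z = z} (w , y≡z+w) (v , x≡y+v) =
  w +ᵥ v , trans x≡y+v (trans (cong (_+ᵥ v) y≡z+w) (zipWith-assoc +-assoc z w v))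

≼-step : ∀ {n} (x : Pt n) (i : Fin n) → x ≼ (x +ᵥ e i)
≼-step x i = e i , refl

≼-split : ∀ {n} {y z : Pt n} {i : Fin n} → y ≼ (z +ᵥ e i) →
  y ≼ z ⊎ Σ (Pt n) λ y' → y ≡ y' +ᵥ e i × y' ≼ z
≼-split {y = y} {z} {i} (v , z+eᵢ≡y+v) with +ᵥ-split y v z i (trans (sym z+eᵢ≡y+v) (+ᵥ-e z i))
... | inj₁ (v' , _ , y+v'≡z) = inj₁ (v' , sym y+v'≡z)
... | inj₂ (y' , refl , y'+v≡z) = inj₂ (y' , sym (+ᵥ-e y' i) , v , sym y'+v≡z)

≼-ind : ∀ {n} {x : Pt n} (Q : Pt n → Set) → Q x →
        (∀ {u} j → (u +ᵥ e j) ≼ x → Q (u +ᵥ e j) → Q u) →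
        ∀ {u} → u ≼ x → Q u
≼-ind {x = x} Q Qx inherit {u} (v , x≡u+v) = go (sum v) u v refl x≡u+v
  where
  go : ∀ m u v → sum v ≡ m → x ≡ u +ᵥ v → Q u
  go m u v sv≡m x≡u+v with zero-or-increment v
  ... | inj₁ refl = subst Q (trans x≡u+v (+ᵥ-identityʳ u)) Qx
  go zero u v sv≡0 x≡u+v | inj₂ (j , v' , refl) =
    contradiction (trans (sym (sum-updateAt v' j)) sv≡0) λ ()
  go (suc m) u v sv≡m x≡u+v | inj₂ (j , v' , refl) =
    inherit j (v' , x≡u+eⱼ+v') (go m (u +ᵥ e j) v' (suc-injective (trans (sym (sum-updateAt v' j)) sv≡m)) x≡u+eⱼ+v')
    where
    x≡u+eⱼ+v' : x ≡ (u +ᵥ e j) +ᵥ v'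
    x≡u+eⱼ+v' = trans x≡u+v (trans (+ᵥ-updateAt u v' j) (cong (_+ᵥ v') (sym (+ᵥ-e u j))))

unique-length-≤ : ∀ {A : Set} {xs ys : List A} → Unique xs →
                  (∀ {z} → z ∈ xs → z ∈ ys) → length xs ≤ length ys
unique-length-≤ {xs = []} _ _ = z≤n
unique-length-≤ {xs = x ∷ xs} {ys} (x∉xs ∷ xs-unique) xs⊆ys
  with ys₁ , ys₂ , refl ← ∈-∃++ (xs⊆ys (here refl)) =
  subst (suc (length xs) ≤_) (sym length-ys)
    (s≤s (unique-length-≤ xs-unique (λ z∈xs → drop-x (xs⊆ys (there z∈xs)) (x≢ z∈xs))))
  where
  x≢ : ∀ {z} → z ∈ xs → z ≢ x
  x≢ z∈xs z≡x = All.lookup x∉xs z∈xs (sym z≡x)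
  drop-x : ∀ {z} → z ∈ ys₁ ++ x ∷ ys₂ → z ≢ x → z ∈ ys₁ ++ ys₂
  drop-x z∈ys z≢x with ∈-++⁻ ys₁ z∈ys
  ... | inj₁ z∈ys₁ = ∈-++⁺ˡ z∈ys₁
  ... | inj₂ (here z≡x) = contradiction z≡x z≢x
  ... | inj₂ (there z∈ys₂) = ∈-++⁺ʳ ys₁ z∈ys₂
  length-ys : length (ys₁ ++ x ∷ ys₂) ≡ suc (length (ys₁ ++ ys₂))
  length-ys = begin
    length (ys₁ ++ x ∷ ys₂)           ≡⟨ length-++ ys₁ ⟩
    length ys₁ + suc (length ys₂)     ≡⟨ +-suc (length ys₁) (length ys₂) ⟩
    suc (length ys₁ + length ys₂)     ≡⟨ cong suc (length-++ ys₁) ⟨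
    suc (length (ys₁ ++ ys₂))         ∎
    where open ≡-Reasoning

∷ʳ-+ᵥ : ∀ {n} (y v : Pt n) (k w : ℕ) → (y ∷ʳ k) +ᵥ (v ∷ʳ w) ≡ (y +ᵥ v) ∷ʳ (k + w)
∷ʳ-+ᵥ [] [] k w = refl
∷ʳ-+ᵥ (a ∷ y) (b ∷ v) k w = cong ((a + b) ∷_) (∷ʳ-+ᵥ y v k w)

module StandardSet {n : ℕ} (Δ : FinSet (suc n)) (std : IsStandard Δ) where
  open import Data.List.Membership.DecPropositional (≡-dec {n = suc n} _≟_) using (_∈?_)

  fibre-down : ∀ {x y k} → y ≼ x → (x ∷ʳ k) ∈ Δ → (y ∷ʳ k) ∈ Δ
  fibre-down {x} {y} {k} (v , x≡y+v) x∈Δ with (y ∷ʳ k) ∈? Δ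
  ... | yes y∈Δ = y∈Δ
  ... | no y∉Δ = contradiction (subst (_∈ Δ) x≡y+v' x∈Δ) (std (y ∷ʳ k) (v ∷ʳ 0) y∉Δ)
    where
    x≡y+v' : x ∷ʳ k ≡ (y ∷ʳ k) +ᵥ (v ∷ʳ 0)
    x≡y+v' = trans (cong₂ _∷ʳ_ x≡y+v (sym (+-identityʳ k))) (sym (∷ʳ-+ᵥ y v k 0))

  bound : ℕ
  bound = suc (max 0 (map last Δ))

  below-bound : ∀ {y k} → (y ∷ʳ k) ∈ Δ → k < bound
  below-bound {y} {k} m = s≤s (subst (_≤ max 0 (map last Δ)) (last-∷ʳ k y)
                                (All.lookup (xs≤max 0 (map last Δ)) (∈-map⁺ last m)))

  height : (y : Pt n) → Σ ℕ (HasHeight Δ y)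
  height y = length fibre , fibre , filter⁺ in-Δ? (upTo⁺ bound) , fibre-members , refl
    where
    in-Δ? : (k : ℕ) → Dec ((y ∷ʳ k) ∈ Δ)
    in-Δ? k = (y ∷ʳ k) ∈? Δ
    fibre : List ℕ
    fibre = filter in-Δ? (upTo bound)
    fibre-members : ∀ k → (k ∈ fibre) ⇔ ((y ∷ʳ k) ∈ Δ)
    fibre-members k = mk⇔ (proj₂ ∘ ∈-filter⁻ in-Δ?) (λ m → ∈-filter⁺ in-Δ? (∈-upTo⁺ (below-bound m)) m)

  antitone : ∀ {x y a b} → y ≼ x → HasHeight Δ x a → HasHeight Δ y b → a ≤ b
  antitone y≼x (ks , ks-unique , ks-fibre , refl) (ks' , _ , ks'-fibre , refl) =
    unique-length-≤ ks-unique λ {k} k∈ks →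
      Equivalence.from (ks'-fibre k) (fibre-down y≼x (Equivalence.to (ks-fibre k) k∈ks))

  height-unique : ∀ {x a b} → HasHeight Δ x a → HasHeight Δ x b → a ≡ b
  height-unique ha hb = ≤-antisym (antitone ≼-refl ha hb) (antitone ≼-refl hb ha)

no-edge-2-4 : ∀ {j j'} → GEdge j j' → label j ≡ 2 → label j' ≡ 4 → ⊥
no-edge-2-4 e12 () _
no-edge-2-4 e23 _ ()
no-edge-2-4 e34 () _
no-edge-2-4 e14 () _

no-edge-1-3 : ∀ {j j'} → GEdge j j' → label j ≡ 1 → label j' ≡ 3 → ⊥
no-edge-1-3 e12 _ ()
no-edge-1-3 e23 () _
no-edge-1-3 e34 () _
no-edge-1-3 e14 _ ()

module IsoToGFacts {n : ℕ} (Δ : FinSet (suc n)) (std : IsStandard Δ)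
                   (c : Pt n → Fin 4) (iso : IsoToG Δ c) where
  open IsoToG iso
  open StandardSet Δ std

  Δ^ : ℕ → Pt n → Set
  Δ^ a = InIsohypse Δ a

  descend : ∀ {x y a} → y ≼ x → Δ^ a x → Σ ℕ λ b → Δ^ b y × a ≤ b
  descend {y = y} {a} y≼x (1≤a , hx) with height y
  ... | b , hy = b , (≤-trans 1≤a a≤b , hy) , a≤b
    where
    a≤b : a ≤ b
    a≤b = antitone y≼x hx hy

  descend-≤ : ∀ {x y a b} → y ≼ x → Δ^ a x → Δ^ b y → a ≤ b
  descend-≤ y≼x (_ , hx) (_ , hy) = antitone y≼x hx hy

  isohypse-unique : ∀ {x a b} → Δ^ a x → Δ^ b x → a ≡ b
  isohypse-unique (_ , ha) (_ , hb) = height-unique ha hb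

  -- All heights are labels of G, hence at most 4.
  height≤4 : ∀ {x a} → Δ^ a x → a ≤ 4
  height≤4 {x} {a} hx = subst (_≤ 4) (sym (labels x a hx)) (toℕ<n (c x))

  relabel : ∀ {x a j} → c x ≡ j → Δ^ a x → Δ^ (label j) x
  relabel {x} {a} cx≡j hx = subst (λ b → Δ^ b x) (trans (labels x a hx) (cong label cx≡j)) hx

  edge-witness : ∀ {j j'} → GEdge j j' →
    Σ (Pt n) λ y' → Σ (Pt n) λ y → Σ (Fin n) λ i →
      Δ^ (label j) y' × Δ^ (label j') y × c y' ≡ j × y' ≡ y +ᵥ e i
  edge-witness {j} {j'} g with Equivalence.to (edges j j') g
  ... | _ , y' , y , _ , _ , i , hy' , hy , cy'≡j , cy≡j' , y'≡y+eᵢ =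
    y' , y , i , relabel cy'≡j hy' , relabel cy≡j' hy , cy'≡j , y'≡y+eᵢ

  step-edge : ∀ {a' a y' y i} → Δ^ a' y' → Δ^ a y → y' ≡ y +ᵥ e i → a' ≢ a →
              GEdge (c y') (c y)
  step-edge {a'} {a} {y'} {y} {i} hy' hy y'≡y+eᵢ a'≢a =
    Equivalence.from (edges (c y') (c y))
      ((λ cy'≡cy → a'≢a (trans (labels y' a' hy') (trans (cong label cy'≡cy) (sym (labels y a hy))))) ,
       y' , y , a' , a , i , hy' , hy , refl , refl , y'≡y+eᵢ)

  no-step-2-4 : ∀ {y' y i} → Δ^ 2 y' → Δ^ 4 y → y' ≡ y +ᵥ e i → ⊥
  no-step-2-4 {y'} {y} hy' hy eq =
    no-edge-2-4 (step-edge hy' hy eq λ ()) (sym (labels y' 2 hy')) (sym (labels y 4 hy))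

  no-step-1-3 : ∀ {y' y i} → Δ^ 1 y' → Δ^ 3 y → y' ≡ y +ᵥ e i → ⊥
  no-step-1-3 {y'} {y} hy' hy eq =
    no-edge-1-3 (step-edge hy' hy eq λ ()) (sym (labels y' 1 hy')) (sym (labels y 3 hy))

  -- Discrete intermediate values: between a point of height 3 and a point of
  -- height 1 above it lies a point of height 2, since heights decrease along
  -- unit steps and cannot jump from 3 to 1.
  pass-through-2 : ∀ {u x} → Δ^ 1 x → u ≼ x → Δ^ 3 u →
                   Σ (Pt n) λ z → u ≼ z × z ≼ x × Δ^ 2 z
  pass-through-2 {x = x} hx = ≼-ind Q Qx inherit
    where
    Q : Pt n → Set
    Q u = Δ^ 3 u → Σ (Pt n) λ z → u ≼ z × z ≼ x × Δ^ 2 z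
    Qx : Q x
    Qx h3 = contradiction (isohypse-unique hx h3) λ ()
    inherit : ∀ {u} j → (u +ᵥ e j) ≼ x → Q (u +ᵥ e j) → Q u
    inherit {u} j u'≼x Qu' hu with descend u'≼x hx
    ... | b , hu' , 1≤b = by-height b hu' 1≤b (descend-≤ (≼-step u j) hu' hu)
      where
      by-height : ∀ b → Δ^ b (u +ᵥ e j) → 1 ≤ b → b ≤ 3 → Σ (Pt n) λ z → u ≼ z × z ≼ x × Δ^ 2 z
      by-height 1 hu' _ _ = contradiction refl (no-step-1-3 hu' hu)
      by-height 2 hu' _ _ = u +ᵥ e j , ≼-step u j , u'≼x , hu'
      by-height 3 hu' _ _ with Qu' hu'
      ... | z , u'≼z , z≼x , hz = z , ≼-trans (≼-step u j) u'≼z , z≼x , hz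
      by-height (suc (suc (suc (suc _)))) _ _ (s≤s (s≤s (s≤s ())))

  -- The invariant carried along the component u₁: no point of height 2 below.
  NoTwoBelow : Pt n → Set
  NoTwoBelow x = ∀ {y} → y ≼ x → ¬ Δ^ 2 y

  above-4 : ∀ {δ γ i} → Δ^ 4 δ → γ ≡ δ +ᵥ e i → NoTwoBelow γ
  above-4 hδ refl y≼γ hy with ≼-split y≼γ
  ... | inj₁ y≼δ = contradiction (descend-≤ y≼δ hδ hy) λ { (s≤s (s≤s ())) }
  ... | inj₂ (y' , y≡y'+eᵢ , y'≼δ) with descend y'≼δ hδ
  ...   | b , hy' , 4≤b =
    no-step-2-4 hy (subst (λ b → Δ^ b y') (≤-antisym (height≤4 hy') 4≤b) hy') y≡y'+eᵢ

  no-two-step : ∀ {x x'} → Δ^ 1 x → Adjacent x x' → NoTwoBelow x → NoTwoBelow x'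
  no-two-step hx (j , inj₂ x≡x'+eⱼ) none y≼x' = none (≼-trans y≼x' (e j , x≡x'+eⱼ))
  no-two-step hx (j , inj₁ refl) none y≼x' hy with ≼-split y≼x'
  ... | inj₁ y≼x = none y≼x hy
  ... | inj₂ (u , y≡u+eⱼ , u≼x) with descend (e j , y≡u+eⱼ) hy
  ...   | b , hu , 2≤b = by-height b hu 2≤b (height≤4 hu)
    where
    by-height : ∀ b → Δ^ b u → 2 ≤ b → b ≤ 4 → ⊥
    by-height 2 hu _ _ = none u≼x hu
    by-height 3 hu _ _ with pass-through-2 hx u≼x hu
    ... | z , _ , z≼x , hz = none z≼x hz
    by-height 4 hu _ _ = no-step-2-4 hy hu y≡u+eⱼ
    by-height 0 _ () _
    by-height 1 _ (s≤s ()) _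
    by-height (suc (suc (suc (suc (suc _))))) _ _ (s≤s (s≤s (s≤s (s≤s ()))))

  no-two-chain : ∀ {x x'} → Chain (Δ^ 1) x x' → NoTwoBelow x → NoTwoBelow x'
  no-two-chain (here _) none = none
  no-two-chain (step hx adj chain) none = no-two-chain chain (no-two-step hx adj none)

  connected : ∀ {x x' a} → Δ^ a x → Δ^ a x' → c x ≡ c x' → Chain (Δ^ a) x x'
  connected {x} {x'} {a} hx hx' cx≡cx' = proj₂ (Equivalence.to (sameComp x x' a a hx hx') cx≡cx')

proposition8p2 : (n : ℕ) → ¬ (Σ (FinSet (suc n)) λ Δ → IsStandard Δ ×
    Σ (Pt n → Fin 4) λ c → IsoToG Δ c)
proposition8p2 n (Δ , std , c , iso) =
  let open IsoToGFacts Δ std c iso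
      (γ' , γ , i , hγ' , hγ , cγ'≡u₁ , γ'≡γ+eᵢ) = edge-witness e14
      (t , s , k , ht , hs , ct≡u₁ , t≡s+eₖ) = edge-witness e12
      γ'⇝t = connected hγ' ht (trans cγ'≡u₁ (sym ct≡u₁))
  in no-two-chain γ'⇝t (above-4 hγ γ'≡γ+eᵢ) (e k , t≡s+eₖ) hs
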